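{- Let $[x_1,x_2,\dots,x_k]$ be a topdrop-valid necklace in $S_n$. If $n$ is even, then the number of indices $i$ with $x_i\equiv1$ or $2\pmod 4$ is even. If $n$ is odd, then the number of indices $i$ with $x_i\equiv2$ or $3\pmod 4$ is even.
   Context: Permutations are in one-line notation $\pi=\pi_1\cdots\pi_n$. The topdrop map $T:S_n\to S_n$ is $T(\pi_1\cdots\pi_n)=\pi_{\pi_1+1}\cdots\pi_n\,\pi_{\pi_1}\pi_{\pi_1-1}\cdots\pi_1$ (first $\pi_1$ entries removed, reversed, appended at the end); it is a bijection. The topdrop-necklace of $\pi$ is the cyclic sequence $[\pi_1,T(\pi)_1,\dots,T^{s-1}(\pi)_1]$, where $s\ge1$ is minimal with $T^s(\pi)=\pi$, considered up to cyclic rotation. A necklace is topdrop-valid in $S_n$ if it is the topdrop-necklace of some $\pi\in S_n$. -}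

module Defs where

open import Data.Nat using (ℕ; zero; suc; _≤_; _<_; _%_; _≡ᵇ_)
open import Data.Bool using (Bool; _∨_)
open import Data.List using (List; []; _∷_; drop; take; reverse; _++_; map; upTo; length; filterᵇ)
open import Data.List.Relation.Binary.Permutation.Propositional using (_↭_)
open import Data.Product using (Σ; ∃; _×_)
open import Relation.Binary.PropositionalEquality using (_≡_; _≢_)
open import Function using (_∘_)

-- First entry π₁ of a one-line permutation (default 0 for the empty list, only relevant for n = 0).
head₀ : List ℕ → ℕ
head₀ []      = 0
head₀ (x ∷ _) = x

-- π ∈ S_n in one-line notation: a rearrangement of 1,2,…,n.
IsPerm : ℕ → List ℕ → Set
IsPerm n π = π ↭ map suc (upTo n)

topdrop : List ℕ → List ℕ
topdrop π = drop (head₀ π) π ++ reverse (take (head₀ π) π)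

topdrop^ : ℕ → List ℕ → List ℕ
topdrop^ zero    π = π
topdrop^ (suc k) π = topdrop (topdrop^ k π)

IsMinPeriod : List ℕ → ℕ → Set
IsMinPeriod π s = (1 ≤ s) × (topdrop^ s π ≡ π) × (∀ t → 1 ≤ t → t < s → topdrop^ t π ≢ π)

necklaceSeq : List ℕ → ℕ → List ℕ
necklaceSeq π s = map (λ i → head₀ (topdrop^ i π)) (upTo s)

IsRotation : List ℕ → List ℕ → Set
IsRotation xs ys = ∃ λ i → ys ≡ drop i xs ++ take i xs

-- A necklace (given by any representative sequence) is topdrop-valid in S_n.
TopdropValid : ℕ → List ℕ → Set
TopdropValid n xs =
  Σ (List ℕ) λ π → IsPerm n π × (Σ ℕ λ s → IsMinPeriod π s × IsRotation (necklaceSeq π s) xs)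

count : (ℕ → Bool) → List ℕ → ℕ
count p xs = length (filterᵇ p xs)

is12mod4 : ℕ → Bool
is12mod4 x = (x % 4 ≡ᵇ 1) ∨ (x % 4 ≡ᵇ 2)

is23mod4 : ℕ → Bool
is23mod4 x = (x % 4 ≡ᵇ 2) ∨ (x % 4 ≡ᵇ 3)

{-# OPTIONS --safe #-}
-- Write π = xs ++ ys with length xs = π₁ = k, so that T(π) = ys ++ reverse xs. Reversing xs
-- flips each of its C(k,2) pairs and moving xs past ys flips each of the k(n − k) mixed pairs,
-- so inv π + inv T(π) ≡ C(k,2) + k(n − k) (mod 2). For n even this is odd iff k ≡ 1, 2 (mod 4),
-- for n odd iff k ≡ 2, 3 (mod 4). Along a cycle of T these parity changes telescope to
-- inv π + inv T^s(π) = 2 inv π, so there is an even number of them.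
module Submission where

open import Defs
open import Data.Nat using (ℕ)
open import Data.Nat.Divisibility using (_∣_)
open import Data.List using (List)
open import Data.Product using (_×_)
open import Relation.Nullary using (¬_)

open import Data.Bool using (Bool; true; false; T?)
open import Data.Empty using (⊥-elim)
open import Data.List using ([]; _∷_; [_]; _++_; drop; take; reverse; map; upTo; length; filterᵇ)
open import Data.List.Properties
  using (filter-++; length-++; length-map; length-upTo; map-++; upTo-∷ʳ; unfold-reverse; take++drop≡id; length-take; length-drop)
open import Data.List.Relation.Binary.Permutation.Propositional
  using (_↭_; ↭-sym; ↭-trans; ↭-reflexive; ↭⇒↭ₛ)
open import Data.List.Relation.Binary.Permutation.Propositional.Properties
  using (↭-length; filter-↭; ↭-reverse; ++-comm; ++⁺ʳ; ∈-resp-↭)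
open import Data.List.Relation.Binary.Permutation.Setoid.Properties using (Unique-resp-↭)
open import Data.List.Relation.Unary.All using (All; []; _∷_)
import Data.List.Relation.Unary.All.Properties as All
open import Data.List.Relation.Unary.Any using (here)
open import Data.List.Relation.Unary.Unique.Propositional using (Unique; []; _∷_)
import Data.List.Relation.Unary.Unique.Propositional.Properties as Unique
open import Data.List.Membership.Propositional.Properties using (∈-map⁻; ∈-upTo⁻)
open import Data.Nat using (suc; zero; _+_; _*_; _∸_; _≤_; _<ᵇ_; z≤n; _⊓_; parity)
open import Data.Nat.Divisibility using (divides; ∣-refl; ∣m∣n⇒∣m+n)
open import Data.Nat.Properties
  using (+-commutativeSemigroup; +-identityʳ; +-suc; <-asym; ≮⇒≥; ≤-antisym; <ᵇ-reflects-<; m+[n∸m]≡n; m≤n⇒m⊓n≡m; suc-injective)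
open import Data.Nat.Tactic.RingSolver using (solve-∀)
open import Algebra.Properties.CommutativeSemigroup +-commutativeSemigroup using (interchange)
open import Data.Parity.Base as ℙ using (Parity; 0ℙ; 1ℙ)
open import Data.Parity.Properties using (+-homo-+; *-homo-*; p+p≡0ℙ)
  renaming (+-identityʳ to +ℙ-identityʳ; +-assoc to +ℙ-assoc; *-zeroʳ to *ℙ-zeroʳ)
open import Data.Product using (_,_)
open import Function using (_∘_)
open import Relation.Binary.PropositionalEquality
  using (_≡_; _≢_; refl; sym; trans; cong; cong₂; subst; setoid; module ≡-Reasoning)
open import Relation.Nullary.Reflects using (ofʸ; ofⁿ)

open ≡-Reasoning

parityᵇ : Bool → Parity
parityᵇ false = 0ℙ
parityᵇ true  = 1ℙ

parity-+-2* : ∀ m n → parity (m + 2 * n) ≡ parity m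
parity-+-2* m n = begin
  parity (m + 2 * n)             ≡⟨ +-homo-+ m (2 * n) ⟩
  parity m ℙ.+ parity (2 * n)    ≡⟨ cong (parity m ℙ.+_) (*-homo-* 2 n) ⟩
  parity m ℙ.+ 0ℙ                ≡⟨ +ℙ-identityʳ (parity m) ⟩
  parity m                       ∎

parity≡0ℙ⇒2∣ : ∀ n → parity n ≡ 0ℙ → 2 ∣ n
parity≡0ℙ⇒2∣ zero          _  = divides 0 refl
parity≡0ℙ⇒2∣ 1             ()
parity≡0ℙ⇒2∣ (suc (suc n)) e  = ∣m∣n⇒∣m+n ∣-refl (parity≡0ℙ⇒2∣ n e)

2∣⇒parity≡0ℙ : ∀ {n} → 2 ∣ n → parity n ≡ 0ℙ
2∣⇒parity≡0ℙ (divides q refl) = trans (*-homo-* q 2) (*ℙ-zeroʳ (parity q))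

2∤⇒parity≡1ℙ : ∀ {n} → ¬ 2 ∣ n → parity n ≡ 1ℙ
2∤⇒parity≡1ℙ {n} 2∤n with parity n in eq
... | 0ℙ = ⊥-elim (2∤n (parity≡0ℙ⇒2∣ n eq))
... | 1ℙ = refl

telescope : ∀ a b c → (a ℙ.+ b) ℙ.+ (b ℙ.+ c) ≡ a ℙ.+ c
telescope a b c = begin
  (a ℙ.+ b) ℙ.+ (b ℙ.+ c)   ≡⟨ +ℙ-assoc a b (b ℙ.+ c) ⟩
  a ℙ.+ (b ℙ.+ (b ℙ.+ c))   ≡⟨ cong (a ℙ.+_) (sym (+ℙ-assoc b b c)) ⟩
  a ℙ.+ ((b ℙ.+ b) ℙ.+ c)   ≡⟨ cong (λ z → a ℙ.+ (z ℙ.+ c)) (p+p≡0ℙ b) ⟩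
  a ℙ.+ c                   ∎

choose2 : ℕ → ℕ
choose2 zero    = 0
choose2 (suc k) = k + choose2 k

choose2-+4 : ∀ k → choose2 (4 + k) ≡ choose2 k + 2 * (2 * k + 3)
choose2-+4 k = expand k (choose2 k)
  where
  expand : ∀ j c → 3 + j + (2 + j + (1 + j + (j + c))) ≡ c + 2 * (2 * j + 3)
  expand = solve-∀

parity-choose2-+4 : ∀ k → parity (choose2 (4 + k)) ≡ parity (choose2 k)
parity-choose2-+4 k = trans (cong parity (choose2-+4 k)) (parity-+-2* (choose2 k) (2 * k + 3))

is12mod4-parity : ∀ k → parityᵇ (is12mod4 k) ≡ parity (choose2 k) ℙ.+ parity k
is12mod4-parity 0 = refl
is12mod4-parity 1 = refl
is12mod4-parity 2 = refl
is12mod4-parity 3 = refl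
is12mod4-parity (suc (suc (suc (suc k)))) =
  trans (is12mod4-parity k) (cong (ℙ._+ parity k) (sym (parity-choose2-+4 k)))

is23mod4-parity : ∀ k → parityᵇ (is23mod4 k) ≡ parity (choose2 k)
is23mod4-parity 0 = refl
is23mod4-parity 1 = refl
is23mod4-parity 2 = refl
is23mod4-parity 3 = refl
is23mod4-parity (suc (suc (suc (suc k)))) = trans (is23mod4-parity k) (sym (parity-choose2-+4 k))

oddTopdrop : Parity → ℕ → Bool
oddTopdrop 0ℙ = is12mod4
oddTopdrop 1ℙ = is23mod4

oddTopdrop-parity : ∀ k m → parityᵇ (oddTopdrop (parity (k + m)) k) ≡ parity (choose2 k + k * m)
oddTopdrop-parity k m
  rewrite +-homo-+ k m | +-homo-+ (choose2 k) (k * m) | *-homo-* k m = cases (parity k) (parity m) refl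
  where
  cases : ∀ p q → parity k ≡ p → parityᵇ (oddTopdrop (p ℙ.+ q) k) ≡ parity (choose2 k) ℙ.+ (p ℙ.* q)
  cases 0ℙ 0ℙ e = trans (is12mod4-parity k) (cong (parity (choose2 k) ℙ.+_) e)
  cases 1ℙ 1ℙ e = trans (is12mod4-parity k) (cong (parity (choose2 k) ℙ.+_) e)
  cases 0ℙ 1ℙ _ = trans (is23mod4-parity k) (sym (+ℙ-identityʳ _))
  cases 1ℙ 0ℙ _ = trans (is23mod4-parity k) (sym (+ℙ-identityʳ _))

count-++ : ∀ p xs ys → count p (xs ++ ys) ≡ count p xs + count p ys
count-++ p xs ys = trans (cong length (filter-++ (T? ∘ p) xs ys)) (length-++ (filterᵇ p xs))

count-↭ : ∀ p {xs ys} → xs ↭ ys → count p xs ≡ count p ys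
count-↭ p xs↭ys = ↭-length (filter-↭ (T? ∘ p) xs↭ys)

count-reverse : ∀ p xs → count p (reverse xs) ≡ count p xs
count-reverse p xs = count-↭ p (↭-reverse xs)

parity-count-[x] : ∀ p x → parity (count p [ x ]) ≡ parityᵇ (p x)
parity-count-[x] p x with p x
... | true  = refl
... | false = refl

count<+count>≡length : ∀ a ys → All (a ≢_) ys → count (_<ᵇ a) ys + count (a <ᵇ_) ys ≡ length ys
count<+count>≡length a []       []            = refl
count<+count>≡length a (y ∷ ys) (a≢y ∷ a∉ys)
  with y <ᵇ a | <ᵇ-reflects-< y a | a <ᵇ y | <ᵇ-reflects-< a y
... | true  | ofʸ y<a | true  | ofʸ a<y = ⊥-elim (<-asym y<a a<y)
... | true  | ofʸ _   | false | ofⁿ _   = cong suc (count<+count>≡length a ys a∉ys)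
... | false | ofⁿ _   | true  | ofʸ _   =
  trans (+-suc (count (_<ᵇ a) ys) _) (cong suc (count<+count>≡length a ys a∉ys))
... | false | ofⁿ y≮a | false | ofⁿ a≮y = ⊥-elim (a≢y (≤-antisym (≮⇒≥ y≮a) (≮⇒≥ a≮y)))

inversions : List ℕ → ℕ
inversions []       = 0
inversions (x ∷ xs) = count (_<ᵇ x) xs + inversions xs

crossings : List ℕ → List ℕ → ℕ
crossings []       ys = 0
crossings (x ∷ xs) ys = count (_<ᵇ x) ys + crossings xs ys

crossings-[]ʳ : ∀ xs → crossings xs [] ≡ 0
crossings-[]ʳ []       = refl
crossings-[]ʳ (x ∷ xs) = crossings-[]ʳ xs

count<[y]≡count>[x] : ∀ x y → count (_<ᵇ x) [ y ] ≡ count (y <ᵇ_) [ x ]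
count<[y]≡count>[x] x y with y <ᵇ x
... | true  = refl
... | false = refl

crossings-consʳ : ∀ xs y ys → crossings xs (y ∷ ys) ≡ count (y <ᵇ_) xs + crossings xs ys
crossings-consʳ []       y ys = refl
crossings-consʳ (x ∷ xs) y ys = begin
  count (_<ᵇ x) (y ∷ ys) + crossings xs (y ∷ ys)
    ≡⟨ cong₂ _+_ (count-++ (_<ᵇ x) [ y ] ys) (crossings-consʳ xs y ys) ⟩
  (count (_<ᵇ x) [ y ] + count (_<ᵇ x) ys) + (count (y <ᵇ_) xs + crossings xs ys)
    ≡⟨ interchange (count (_<ᵇ x) [ y ]) (count (_<ᵇ x) ys) (count (y <ᵇ_) xs) (crossings xs ys) ⟩
  (count (_<ᵇ x) [ y ] + count (y <ᵇ_) xs) + (count (_<ᵇ x) ys + crossings xs ys)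
    ≡⟨ cong (λ c → (c + count (y <ᵇ_) xs) + _) (count<[y]≡count>[x] x y) ⟩
  (count (y <ᵇ_) [ x ] + count (y <ᵇ_) xs) + (count (_<ᵇ x) ys + crossings xs ys)
    ≡⟨ cong (_+ _) (sym (count-++ (y <ᵇ_) [ x ] xs)) ⟩
  count (y <ᵇ_) (x ∷ xs) + crossings (x ∷ xs) ys ∎

crossings-reverseʳ : ∀ xs ys → crossings xs (reverse ys) ≡ crossings xs ys
crossings-reverseʳ []       ys = refl
crossings-reverseʳ (x ∷ xs) ys = cong₂ _+_ (count-reverse (_<ᵇ x) ys) (crossings-reverseʳ xs ys)

crossings-both-ways : ∀ xs ys → Unique (xs ++ ys) →
                      crossings xs ys + crossings ys xs ≡ length xs * length ys
crossings-both-ways []       ys _ = crossings-[]ʳ ys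
crossings-both-ways (x ∷ xs) ys (x∉xs++ys ∷ unique) = begin
  (count (_<ᵇ x) ys + crossings xs ys) + crossings ys (x ∷ xs)
    ≡⟨ cong (count (_<ᵇ x) ys + crossings xs ys +_) (crossings-consʳ ys x xs) ⟩
  (count (_<ᵇ x) ys + crossings xs ys) + (count (x <ᵇ_) ys + crossings ys xs)
    ≡⟨ interchange (count (_<ᵇ x) ys) (crossings xs ys) (count (x <ᵇ_) ys) (crossings ys xs) ⟩
  (count (_<ᵇ x) ys + count (x <ᵇ_) ys) + (crossings xs ys + crossings ys xs)
    ≡⟨ cong₂ _+_ (count<+count>≡length x ys (All.++⁻ʳ xs x∉xs++ys)) (crossings-both-ways xs ys unique) ⟩
  length ys + length xs * length ys ∎

inversions-++ : ∀ xs ys → inversions (xs ++ ys) ≡ inversions xs + inversions ys + crossings xs ys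
inversions-++ []       ys = sym (+-identityʳ (inversions ys))
inversions-++ (x ∷ xs) ys = begin
  count (_<ᵇ x) (xs ++ ys) + inversions (xs ++ ys)
    ≡⟨ cong₂ _+_ (count-++ (_<ᵇ x) xs ys) (inversions-++ xs ys) ⟩
  (count (_<ᵇ x) xs + count (_<ᵇ x) ys) + (inversions xs + inversions ys + crossings xs ys)
    ≡⟨ rearrange (count (_<ᵇ x) xs) (count (_<ᵇ x) ys) (inversions xs) (inversions ys) _ ⟩
  (count (_<ᵇ x) xs + inversions xs) + inversions ys + (count (_<ᵇ x) ys + crossings xs ys) ∎
  where
  rearrange : ∀ a b c d e → (a + b) + (c + d + e) ≡ (a + c) + d + (b + e)
  rearrange = solve-∀

unique-++⁻ˡ : ∀ xs {ys : List ℕ} → Unique (xs ++ ys) → Unique xs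
unique-++⁻ˡ []       _                  = []
unique-++⁻ˡ (x ∷ xs) (x∉xs++ys ∷ unique) = All.++⁻ˡ xs x∉xs++ys ∷ unique-++⁻ˡ xs unique

inversions-reverse : ∀ xs → Unique xs → inversions xs + inversions (reverse xs) ≡ choose2 (length xs)
inversions-reverse []       _               = refl
inversions-reverse (x ∷ xs) (x∉xs ∷ unique) = begin
  (count (_<ᵇ x) xs + inversions xs) + inversions (reverse (x ∷ xs))
    ≡⟨ cong (λ zs → count (_<ᵇ x) xs + inversions xs + inversions zs) (unfold-reverse x xs) ⟩
  (count (_<ᵇ x) xs + inversions xs) + inversions (reverse xs ++ [ x ])
    ≡⟨ cong (count (_<ᵇ x) xs + inversions xs +_) (inversions-++ (reverse xs) [ x ]) ⟩
  (count (_<ᵇ x) xs + inversions xs) + (inversions (reverse xs) + 0 + crossings (reverse xs) [ x ])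
    ≡⟨ cong (λ c → count (_<ᵇ x) xs + inversions xs + (inversions (reverse xs) + 0 + c)) crossings-[x] ⟩
  (count (_<ᵇ x) xs + inversions xs) + (inversions (reverse xs) + 0 + (count (x <ᵇ_) xs + 0))
    ≡⟨ rearrange (count (_<ᵇ x) xs) (inversions xs) (inversions (reverse xs)) (count (x <ᵇ_) xs) ⟩
  (count (_<ᵇ x) xs + count (x <ᵇ_) xs) + (inversions xs + inversions (reverse xs))
    ≡⟨ cong₂ _+_ (count<+count>≡length x xs x∉xs) (inversions-reverse xs unique) ⟩
  length xs + choose2 (length xs) ∎
  where
  crossings-[x] : crossings (reverse xs) [ x ] ≡ count (x <ᵇ_) xs + 0
  crossings-[x] = trans (crossings-consʳ (reverse xs) x [])
                        (cong₂ _+_ (count-reverse (x <ᵇ_) xs) (crossings-[]ʳ (reverse xs)))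
  rearrange : ∀ a b c d → (a + b) + (c + 0 + (d + 0)) ≡ (a + d) + (b + c)
  rearrange = solve-∀

inversions-prefix-flip : ∀ xs ys → Unique (xs ++ ys) →
  inversions (xs ++ ys) + inversions (ys ++ reverse xs) ≡
  choose2 (length xs) + length xs * length ys + 2 * inversions ys
inversions-prefix-flip xs ys unique = begin
  inversions (xs ++ ys) + inversions (ys ++ reverse xs)
    ≡⟨ cong₂ _+_ (inversions-++ xs ys) (inversions-++ ys (reverse xs)) ⟩
  (inversions xs + inversions ys + crossings xs ys) +
  (inversions ys + inversions (reverse xs) + crossings ys (reverse xs))
    ≡⟨ cong (λ c → inversions xs + inversions ys + crossings xs ys + (inversions ys + inversions (reverse xs) + c))
            (crossings-reverseʳ ys xs) ⟩
  (inversions xs + inversions ys + crossings xs ys) +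
  (inversions ys + inversions (reverse xs) + crossings ys xs)
    ≡⟨ rearrange (inversions xs) (inversions ys) (crossings xs ys) (inversions (reverse xs)) (crossings ys xs) ⟩
  (inversions xs + inversions (reverse xs)) + (crossings xs ys + crossings ys xs) + 2 * inversions ys
    ≡⟨ cong₂ (λ a b → a + b + 2 * inversions ys)
             (inversions-reverse xs (unique-++⁻ˡ xs unique)) (crossings-both-ways xs ys unique) ⟩
  choose2 (length xs) + length xs * length ys + 2 * inversions ys ∎
  where
  rearrange : ∀ a b c d e → (a + b + c) + (b + d + e) ≡ (a + d) + (c + e) + 2 * b
  rearrange = solve-∀

IsPerm⇒Unique : ∀ {n π} → IsPerm n π → Unique π
IsPerm⇒Unique {n} π↭ =
  Unique-resp-↭ (setoid ℕ) (↭⇒↭ₛ (↭-sym π↭)) (Unique.map⁺ suc-injective (Unique.upTo⁺ n))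

IsPerm⇒length≡ : ∀ {n π} → IsPerm n π → length π ≡ n
IsPerm⇒length≡ {n} π↭ = trans (↭-length π↭) (trans (length-map suc (upTo n)) (length-upTo n))

IsPerm⇒head₀≤ : ∀ {n π} → IsPerm n π → head₀ π ≤ n
IsPerm⇒head₀≤ {π = []}    _  = z≤n
IsPerm⇒head₀≤ {π = x ∷ π} π↭ with ∈-map⁻ suc (∈-resp-↭ π↭ (here refl))
... | _ , i∈upTo , refl = ∈-upTo⁻ i∈upTo

topdrop-↭ : ∀ π → topdrop π ↭ π
topdrop-↭ π = ↭-trans (++-comm (drop k π) (reverse (take k π)))
             (↭-trans (++⁺ʳ (drop k π) (↭-reverse (take k π))) (↭-reflexive (take++drop≡id k π)))
  where k = head₀ π

IsPerm-topdrop^ : ∀ {n π} i → IsPerm n π → IsPerm n (topdrop^ i π)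
IsPerm-topdrop^ zero    π↭ = π↭
IsPerm-topdrop^ (suc i) π↭ = ↭-trans (topdrop-↭ _) (IsPerm-topdrop^ i π↭)

topdrop-inversions-parity : ∀ {n π} → IsPerm n π →
  parity (inversions π) ℙ.+ parity (inversions (topdrop π)) ≡ parityᵇ (oddTopdrop (parity n) (head₀ π))
topdrop-inversions-parity {n} {π} π↭ = begin
  parity (inversions π) ℙ.+ parity (inversions (ys ++ reverse xs))
    ≡⟨ sym (+-homo-+ (inversions π) _) ⟩
  parity (inversions π + inversions (ys ++ reverse xs))
    ≡⟨ cong (λ ρ → parity (inversions ρ + inversions (ys ++ reverse xs))) (sym (take++drop≡id k π)) ⟩
  parity (inversions (xs ++ ys) + inversions (ys ++ reverse xs))
    ≡⟨ cong parity (inversions-prefix-flip xs ys unique) ⟩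
  parity (choose2 (length xs) + length xs * length ys + 2 * inversions ys)
    ≡⟨ parity-+-2* (choose2 (length xs) + length xs * length ys) (inversions ys) ⟩
  parity (choose2 (length xs) + length xs * length ys)
    ≡⟨ cong₂ (λ a b → parity (choose2 a + a * b)) |xs|≡k |ys|≡n∸k ⟩
  parity (choose2 k + k * (n ∸ k))
    ≡⟨ sym (oddTopdrop-parity k (n ∸ k)) ⟩
  parityᵇ (oddTopdrop (parity (k + (n ∸ k))) k)
    ≡⟨ cong (λ m → parityᵇ (oddTopdrop (parity m) k)) (m+[n∸m]≡n k≤n) ⟩
  parityᵇ (oddTopdrop (parity n) k) ∎
  where
  k = head₀ π
  xs = take k π
  ys = drop k π
  k≤n = IsPerm⇒head₀≤ π↭
  unique : Unique (xs ++ ys)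
  unique = subst Unique (sym (take++drop≡id k π)) (IsPerm⇒Unique π↭)
  |xs|≡k : length xs ≡ k
  |xs|≡k = trans (length-take k π) (trans (cong (k ⊓_) (IsPerm⇒length≡ π↭)) (m≤n⇒m⊓n≡m k≤n))
  |ys|≡n∸k : length ys ≡ n ∸ k
  |ys|≡n∸k = trans (length-drop k π) (cong (_∸ k) (IsPerm⇒length≡ π↭))

necklaceSeq-suc : ∀ π s → necklaceSeq π (suc s) ≡ necklaceSeq π s ++ [ head₀ (topdrop^ s π) ]
necklaceSeq-suc π s = trans (cong (map f) (sym (upTo-∷ʳ s))) (map-++ f (upTo s) [ s ])
  where f = λ i → head₀ (topdrop^ i π)

necklaceSeq-parity : ∀ {n π} → IsPerm n π → ∀ s →
  parity (count (oddTopdrop (parity n)) (necklaceSeq π s)) ≡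
  parity (inversions π) ℙ.+ parity (inversions (topdrop^ s π))
necklaceSeq-parity {π = π} _ zero = sym (p+p≡0ℙ (parity (inversions π)))
necklaceSeq-parity {n} {π} π↭ (suc s) = begin
  parity (count flips (necklaceSeq π (suc s)))
    ≡⟨ cong (parity ∘ count flips) (necklaceSeq-suc π s) ⟩
  parity (count flips (necklaceSeq π s ++ [ head₀ ρ ]))
    ≡⟨ cong parity (count-++ flips (necklaceSeq π s) [ head₀ ρ ]) ⟩
  parity (count flips (necklaceSeq π s) + count flips [ head₀ ρ ])
    ≡⟨ +-homo-+ (count flips (necklaceSeq π s)) _ ⟩
  parity (count flips (necklaceSeq π s)) ℙ.+ parity (count flips [ head₀ ρ ])
    ≡⟨ cong₂ ℙ._+_ (necklaceSeq-parity π↭ s) (parity-count-[x] flips (head₀ ρ)) ⟩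
  (parity (inversions π) ℙ.+ parity (inversions ρ)) ℙ.+ parityᵇ (flips (head₀ ρ))
    ≡⟨ cong (parity (inversions π) ℙ.+ parity (inversions ρ) ℙ.+_)
            (sym (topdrop-inversions-parity (IsPerm-topdrop^ s π↭))) ⟩
  (parity (inversions π) ℙ.+ parity (inversions ρ)) ℙ.+
  (parity (inversions ρ) ℙ.+ parity (inversions (topdrop ρ)))
    ≡⟨ telescope (parity (inversions π)) (parity (inversions ρ)) (parity (inversions (topdrop ρ))) ⟩
  parity (inversions π) ℙ.+ parity (inversions (topdrop ρ)) ∎
  where
  flips = oddTopdrop (parity n)
  ρ = topdrop^ s π

rotation-↭ : ∀ i (xs : List ℕ) → drop i xs ++ take i xs ↭ xs
rotation-↭ i xs = ↭-trans (++-comm (drop i xs) (take i xs)) (↭-reflexive (take++drop≡id i xs))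

TopdropValid⇒even : ∀ {n xs} → TopdropValid n xs → parity (count (oddTopdrop (parity n)) xs) ≡ 0ℙ
TopdropValid⇒even {n} (π , π↭ , s , (_ , Tˢπ≡π , _) , i , refl) = begin
  parity (count flips (drop i N ++ take i N))
    ≡⟨ cong parity (count-↭ flips (rotation-↭ i N)) ⟩
  parity (count flips N)
    ≡⟨ necklaceSeq-parity π↭ s ⟩
  parity (inversions π) ℙ.+ parity (inversions (topdrop^ s π))
    ≡⟨ cong (λ ρ → parity (inversions π) ℙ.+ parity (inversions ρ)) Tˢπ≡π ⟩
  parity (inversions π) ℙ.+ parity (inversions π)
    ≡⟨ p+p≡0ℙ (parity (inversions π)) ⟩
  0ℙ ∎
  where
  flips = oddTopdrop (parity n)
  N = necklaceSeq π s

theorem5p2 : (n : ℕ) (xs : List ℕ) → TopdropValid n xs →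
    ((2 ∣ n) → 2 ∣ count is12mod4 xs) × (¬ (2 ∣ n) → 2 ∣ count is23mod4 xs)
theorem5p2 n xs valid = (λ 2∣n → even (2∣⇒parity≡0ℙ 2∣n)) , (λ 2∤n → even (2∤⇒parity≡1ℙ 2∤n))
  where
  even : ∀ {p} → parity n ≡ p → 2 ∣ count (oddTopdrop p) xs
  even refl = parity≡0ℙ⇒2∣ _ (TopdropValid⇒even valid)
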